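{- Let $G$ be a graph of order $n$, where $n\equiv 2\pmod 3$, with $\chi(G)=3$. Suppose that every proper $3$-coloring of $G$, with color classes $C_1,C_2,C_3$ ordered so that $|C_1|\le|C_2|\le|C_3|$, satisfies: (1) $|C_1|=\lfloor n/3\rfloor$ and $|C_2|=|C_3|=\lfloor n/3\rfloor+1$; (2) for $i\in\{2,3\}$, the induced subgraph $G[C_1\cup C_i]$ is a complete bipartite graph with bipartition $(C_1,C_i)$; (3) for every $i\in[3]$, every $v\in C_i$ and every $j\in[3]\setminus\{i\}$, $e(v,C_j)\ge\lfloor n/3\rfloor$. Then ${\rm es}_{\chi}(G)=\lfloor n/3\rfloor\lfloor n/3+1\rfloor$.
   Context: All graphs are finite and simple; $\chi$ denotes the chromatic number. The $\chi$-stability index ${\rm es}_{\chi}(G)$ of a graph $G$ with at least one edge is the minimum number of edges whose removal yields a spanning subgraph with chromatic number smaller than $\chi(G)$. For a vertex $v$ and a vertex set $B$, $e(v,B)$ denotes the number of edges joining $v$ to vertices of $B$. $G[A]$ is the subgraph induced by $A$. -}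

module Defs where

open import Data.Nat using (ℕ; _≤_; _<_; _<ᵇ_)
open import Data.Fin using (Fin; toℕ; _≟_)
open import Data.Bool using (Bool; true; false; _∧_; if_then_else_)
open import Data.List using (List; length; filter; map; allFin)
open import Data.Nat.ListAction using (sum)
open import Data.Product using (Σ; _×_; ∃)
open import Relation.Binary.PropositionalEquality using (_≡_; _≢_)

record Graph (n : ℕ) : Set where
  field
    adj    : Fin n → Fin n → Bool
    sym    : ∀ u v → adj u v ≡ adj v u
    irrefl : ∀ v → adj v v ≡ false
open Graph public

_⊆G_ : ∀ {n} → Graph n → Graph n → Set
H ⊆G G = ∀ u v → adj H u v ≡ true → adj G u v ≡ true

IsProperColoring : ∀ {n k} → Graph n → (Fin n → Fin k) → Set
IsProperColoring G c = ∀ u v → adj G u v ≡ true → c u ≢ c v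

Colorable : ∀ {n} → Graph n → ℕ → Set
Colorable {n} G k = Σ (Fin n → Fin k) (IsProperColoring G)

IsChi : ∀ {n} → Graph n → ℕ → Set
IsChi G k = Colorable G k × (∀ m → Colorable G m → k ≤ m)

ChiSmaller : ∀ {n} → Graph n → Graph n → Set
ChiSmaller H G = ∀ k → IsChi G k → ∃ λ m → IsChi H m × m < k

edgeCount : ∀ {n} → Graph n → ℕ
edgeCount {n} G =
  sum (map (λ u → sum (map (λ v → if adj G u v ∧ (toℕ u <ᵇ toℕ v) then 1 else 0)
                            (allFin n)))
           (allFin n))

IsEsChi : ∀ {n} → Graph n → ℕ → Set
IsEsChi {n} G s =
  (∃ λ (H : Graph n) → H ⊆G G × ChiSmaller H G × edgeCount G Data.Nat.∸ edgeCount H ≡ s)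
  × (∀ (H : Graph n) → H ⊆G G → ChiSmaller H G → s ≤ edgeCount G Data.Nat.∸ edgeCount H)

classSize : ∀ {n k} → (Fin n → Fin k) → Fin k → ℕ
classSize {n} c a = length (filter (λ v → c v ≟ a) (allFin n))

eToClass : ∀ {n k} → Graph n → (Fin n → Fin k) → Fin n → Fin k → ℕ
eToClass {n} G c v j =
  length (filter (λ w → c w ≟ j) (filter (λ w → adj G v w Data.Bool.≟ true) (allFin n)))

module Submission where

-- Fix one such colouring.  Edge sets are counted as unordered pairs (pairs),
-- and the handshake lemma converts such counts into sums of degrees.
--   Upper bound (UpperBound): deleting the k(k + 1) edges between A and B
--   leaves exactly the edges meeting D, properly 2-coloured by membership in D;
--   an A–D edge survives, so the chromatic number drops to 2.
--   Lower bound: if H ⊆ G has χ(H) < 3, a 2-colouring of H splits V(G) into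
--   two sides and every edge of G inside a side was deleted (lost-edges).  For
--   any bipartition, the same-side degrees are bounded below using the complete
--   joins at A and the degree condition at B and D (SameSideCount); summing
--   them reduces the claim to the inequality bipartitionBound.

open import Defs
open import Data.Nat using (ℕ; _≤_; _+_; _*_; _/_; _%_)
open import Data.Fin using (Fin)
open import Data.Bool using (true)
open import Relation.Binary.PropositionalEquality using (_≡_; _≢_)
open import Data.Product using (_×_)

open import Data.Nat using (zero; suc; _∸_; z≤n; s≤s; _<ᵇ_)
open import Data.Nat.Properties hiding (_≟_)
open import Data.Nat.DivMod using (m≡m%n+[m/n]*n)
open import Data.Nat.ListAction using (sum)
open import Data.Nat.Tactic.RingSolver using (solve-∀)
open import Algebra.Properties.CommutativeSemigroup +-commutativeSemigroup using (interchange)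
open import Data.Bool using (Bool; false; _∧_; _∨_; not; if_then_else_)
open import Data.Bool.Properties using (∧-conicalˡ; ∧-conicalʳ; ∧-zeroʳ; ∨-comm; ∨-zeroʳ)
import Data.Bool as Bool
open import Data.Fin using (zero; suc; toℕ; _≟_)
open import Data.Fin.Properties using (toℕ-injective; all?)
open import Data.List using (List; []; _∷_; length; filter; map; allFin)
open import Data.Sum using (_⊎_; inj₁; inj₂)
open import Data.Product using (Σ; _,_; proj₁; proj₂)
open import Data.Empty using (⊥; ⊥-elim)
open import Data.Unit using (tt)
open import Function using (id; _∘_)
open import Relation.Nullary using (Dec; does; yes; no; ¬?; contradiction)
open import Relation.Nullary.Decidable using (toWitness; dec-true; dec-false; _⊎-dec_; _→-dec_)
open import Relation.Unary using (Pred; Decidable)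
open import Relation.Binary.PropositionalEquality
  using (refl; trans; cong; cong₂; subst; ≢-sym; module ≡-Reasoning) renaming (sym to ≡-sym)

⟦_⟧ : Bool → ℕ
⟦ b ⟧ = if b then 1 else 0

⟦∧⟧ : ∀ x y → ⟦ x ∧ y ⟧ ≡ ⟦ x ⟧ * ⟦ y ⟧
⟦∧⟧ false y = refl
⟦∧⟧ true false = refl
⟦∧⟧ true true = refl

module FiniteSums {A : Set} where

  ∑ : List A → (A → ℕ) → ℕ
  ∑ xs f = sum (map f xs)

  syntax ∑ xs (λ x → e) = ∑[ x ∈ xs ] e

  ∑-+ : ∀ xs (f g : A → ℕ) → ∑[ x ∈ xs ] (f x + g x) ≡ ∑ xs f + ∑ xs g
  ∑-+ [] f g = refl
  ∑-+ (x ∷ xs) f g = trans (cong (f x + g x +_) (∑-+ xs f g)) (interchange (f x) (g x) (∑ xs f) (∑ xs g))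

  ∑-cong : ∀ xs {f g : A → ℕ} → (∀ x → f x ≡ g x) → ∑ xs f ≡ ∑ xs g
  ∑-cong [] eq = refl
  ∑-cong (x ∷ xs) eq = cong₂ _+_ (eq x) (∑-cong xs eq)

  ∑-mono : ∀ xs {f g : A → ℕ} → (∀ x → f x ≤ g x) → ∑ xs f ≤ ∑ xs g
  ∑-mono [] le = z≤n
  ∑-mono (x ∷ xs) le = +-mono-≤ (le x) (∑-mono xs le)

  ∑-*ˡ : ∀ xs m (f : A → ℕ) → ∑[ x ∈ xs ] (m * f x) ≡ m * ∑ xs f
  ∑-*ˡ [] m f = ≡-sym (*-zeroʳ m)
  ∑-*ˡ (x ∷ xs) m f = trans (cong (m * f x +_) (∑-*ˡ xs m f)) (≡-sym (*-distribˡ-+ m (f x) (∑ xs f)))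

  ∑-*ʳ : ∀ xs m (f : A → ℕ) → ∑[ x ∈ xs ] (f x * m) ≡ ∑ xs f * m
  ∑-*ʳ xs m f = trans (∑-cong xs (λ x → *-comm (f x) m)) (trans (∑-*ˡ xs m f) (*-comm m (∑ xs f)))

  ∑-zero : ∀ xs → ∑[ x ∈ xs ] 0 ≡ 0
  ∑-zero [] = refl
  ∑-zero (x ∷ xs) = ∑-zero xs

  length-filter : ∀ {ℓ} {P : Pred A ℓ} (P? : Decidable P) xs →
    length (filter P? xs) ≡ ∑[ x ∈ xs ] ⟦ does (P? x) ⟧
  length-filter P? [] = refl
  length-filter P? (x ∷ xs) with does (P? x)
  ... | false = length-filter P? xs
  ... | true = cong suc (length-filter P? xs)

  length-filter² : ∀ {ℓ ℓ′} {P : Pred A ℓ} {Q : Pred A ℓ′} (P? : Decidable P) (Q? : Decidable Q) xs →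
    length (filter Q? (filter P? xs)) ≡ ∑[ x ∈ xs ] ⟦ does (P? x) ∧ does (Q? x) ⟧
  length-filter² P? Q? [] = refl
  length-filter² P? Q? (x ∷ xs) with does (P? x)
  ... | false = length-filter² P? Q? xs
  ... | true with does (Q? x)
  ...   | false = length-filter² P? Q? xs
  ...   | true = cong suc (length-filter² P? Q? xs)

open FiniteSums

∑-swap : ∀ {A B : Set} (xs : List A) (ys : List B) (f : A → B → ℕ) →
  ∑[ x ∈ xs ] ∑[ y ∈ ys ] f x y ≡ ∑[ y ∈ ys ] ∑[ x ∈ xs ] f x y
∑-swap [] ys f = ≡-sym (∑-zero ys)
∑-swap (x ∷ xs) ys f = trans (cong (∑ ys (f x) +_) (∑-swap xs ys f)) (≡-sym (∑-+ ys (f x) _))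

∑-product : ∀ {A B : Set} (xs : List A) (ys : List B) (f : A → ℕ) (g : B → ℕ) →
  ∑[ x ∈ xs ] ∑[ y ∈ ys ] (f x * g y) ≡ ∑ xs f * ∑ ys g
∑-product xs ys f g = trans (∑-cong xs (λ x → ∑-*ˡ ys (f x) g)) (∑-*ʳ xs (∑ ys g) f)

bool-ext : ∀ {x y} → (x ≡ true → y ≡ true) → (y ≡ true → x ≡ true) → x ≡ y
bool-ext {false} {false} _ _ = refl
bool-ext {false} {true} _ y⇒x = y⇒x refl
bool-ext {true} {false} x⇒y _ = ≡-sym (x⇒y refl)
bool-ext {true} {true} _ _ = refl

⟦∨⟧ : ∀ x y → (x ≡ true → y ≡ true → ⊥) → ⟦ x ∨ y ⟧ ≡ ⟦ x ⟧ + ⟦ y ⟧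
⟦∨⟧ false y _ = refl
⟦∨⟧ true false _ = refl
⟦∨⟧ true true incompatible = ⊥-elim (incompatible refl refl)

⟦⟧*-≤ : ∀ p n → ⟦ p ⟧ * n ≤ n
⟦⟧*-≤ false n = z≤n
⟦⟧*-≤ true n = ≤-reflexive (+-identityʳ n)

weighted : ∀ p {X Y} → (p ≡ true → X ≤ Y) → ⟦ p ⟧ * X ≤ ⟦ p ⟧ * Y
weighted false _ = z≤n
weighted true X≤Y = *-monoʳ-≤ 1 (X≤Y refl)

partition₂ : ∀ x y {X Y I} → x + y ≡ 1 → x * X ≤ x * I → y * Y ≤ y * I → x * X + y * Y ≤ I
partition₂ x y {X} {Y} {I} x+y≡1 X≤I Y≤I = begin
  x * X + y * Y ≤⟨ +-mono-≤ X≤I Y≤I ⟩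
  x * I + y * I ≡⟨ ≡-sym (*-distribʳ-+ I x y) ⟩
  (x + y) * I   ≡⟨ cong (_* I) x+y≡1 ⟩
  1 * I         ≡⟨ *-identityˡ I ⟩
  I             ∎
  where open ≤-Reasoning

partition₃ : ∀ x y z {X Y Z I} → x + y + z ≡ 1 →
  x * X ≤ x * I → y * Y ≤ y * I → z * Z ≤ z * I → x * X + y * Y + z * Z ≤ I
partition₃ x y z {X} {Y} {Z} {I} x+y+z≡1 X≤I Y≤I Z≤I = begin
  x * X + y * Y + z * Z ≤⟨ +-mono-≤ (+-mono-≤ X≤I Y≤I) Z≤I ⟩
  x * I + y * I + z * I ≡⟨ ≡-sym (cong (_+ z * I) (*-distribʳ-+ I x y)) ⟩
  (x + y) * I + z * I   ≡⟨ ≡-sym (*-distribʳ-+ I (x + y) z) ⟩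
  (x + y + z) * I       ≡⟨ cong (_* I) x+y+z≡1 ⟩
  1 * I                 ≡⟨ *-identityˡ I ⟩
  I                     ∎
  where open ≤-Reasoning

<ᵇ-exclusive : ∀ m n → m ≢ n → ⟦ m <ᵇ n ⟧ + ⟦ n <ᵇ m ⟧ ≡ 1
<ᵇ-exclusive zero zero m≢n = ⊥-elim (m≢n refl)
<ᵇ-exclusive zero (suc n) _ = refl
<ᵇ-exclusive (suc m) zero _ = refl
<ᵇ-exclusive (suc m) (suc n) m≢n = <ᵇ-exclusive m n (m≢n ∘ cong suc)

∧-split : ∀ r q l → ⟦ r ∧ l ⟧ ≡ ⟦ (q ∧ r) ∧ l ⟧ + ⟦ (not q ∧ r) ∧ l ⟧
∧-split r true l = ≡-sym (+-identityʳ ⟦ r ∧ l ⟧)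
∧-split r false l = refl

module PairCounts {n : ℕ} where

  V : List (Fin n)
  V = allFin n

  -- The order used by edgeCount to count each unordered pair once.
  _≺_ : Fin n → Fin n → Bool
  u ≺ v = toℕ u <ᵇ toℕ v

  Rel : Set
  Rel = Fin n → Fin n → Bool

  -- pairs R is the number of unordered pairs {u, v} with R u v; by definition
  -- edgeCount G is pairs (adj G).
  pairs : Rel → ℕ
  pairs R = ∑[ u ∈ V ] ∑[ v ∈ V ] ⟦ R u v ∧ u ≺ v ⟧

  pairs-split : (R Q : Rel) → pairs R ≡ pairs (λ u v → Q u v ∧ R u v) + pairs (λ u v → not (Q u v) ∧ R u v)
  pairs-split R Q =
    trans (∑-cong V (λ u → trans (∑-cong V (λ v → ∧-split (R u v) (Q u v) (u ≺ v))) (∑-+ V _ _))) (∑-+ V _ _)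

  pairs-mono : (R R′ : Rel) → (∀ u v → R u v ≡ true → R′ u v ≡ true) → pairs R ≤ pairs R′
  pairs-mono R R′ R⇒R′ = ∑-mono V (λ u → ∑-mono V (λ v → pointwise u v))
    where
    pointwise : ∀ u v → ⟦ R u v ∧ u ≺ v ⟧ ≤ ⟦ R′ u v ∧ u ≺ v ⟧
    pointwise u v with R u v in eq
    ... | false = z≤n
    ... | true rewrite R⇒R′ u v eq = ≤-refl

  ordered-split : (R : Rel) → (∀ u → R u u ≡ false) → ∀ u v →
    ⟦ R u v ⟧ ≡ ⟦ R u v ∧ u ≺ v ⟧ + ⟦ R u v ∧ v ≺ u ⟧
  ordered-split R irrefl u v with u ≟ v
  ... | yes refl rewrite irrefl u = refl
  ... | no u≢v = begin
    ⟦ R u v ⟧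
      ≡⟨ ≡-sym (*-identityʳ _) ⟩
    ⟦ R u v ⟧ * 1
      ≡⟨ cong (⟦ R u v ⟧ *_) (≡-sym (<ᵇ-exclusive (toℕ u) (toℕ v) (u≢v ∘ toℕ-injective))) ⟩
    ⟦ R u v ⟧ * (⟦ u ≺ v ⟧ + ⟦ v ≺ u ⟧)
      ≡⟨ *-distribˡ-+ ⟦ R u v ⟧ _ _ ⟩
    ⟦ R u v ⟧ * ⟦ u ≺ v ⟧ + ⟦ R u v ⟧ * ⟦ v ≺ u ⟧
      ≡⟨ ≡-sym (cong₂ _+_ (⟦∧⟧ (R u v) (u ≺ v)) (⟦∧⟧ (R u v) (v ≺ u))) ⟩
    ⟦ R u v ∧ u ≺ v ⟧ + ⟦ R u v ∧ v ≺ u ⟧ ∎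
    where open ≡-Reasoning

  handshake : (R : Rel) → (∀ u v → R u v ≡ R v u) → (∀ u → R u u ≡ false) →
    ∑[ u ∈ V ] ∑[ v ∈ V ] ⟦ R u v ⟧ ≡ 2 * pairs R
  handshake R R-sym R-irrefl = begin
    ∑[ u ∈ V ] ∑[ v ∈ V ] ⟦ R u v ⟧
      ≡⟨ ∑-cong V (λ u → trans (∑-cong V (ordered-split R R-irrefl u)) (∑-+ V _ _)) ⟩
    ∑[ u ∈ V ] (∑[ v ∈ V ] ⟦ R u v ∧ u ≺ v ⟧ + ∑[ v ∈ V ] ⟦ R u v ∧ v ≺ u ⟧)
      ≡⟨ ∑-+ V _ _ ⟩
    pairs R + ∑[ u ∈ V ] ∑[ v ∈ V ] ⟦ R u v ∧ v ≺ u ⟧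
      ≡⟨ cong (pairs R +_) reversed ⟩
    pairs R + pairs R
      ≡⟨ cong (pairs R +_) (≡-sym (+-identityʳ (pairs R))) ⟩
    2 * pairs R ∎
    where
    open ≡-Reasoning
    reversed : ∑[ u ∈ V ] ∑[ v ∈ V ] ⟦ R u v ∧ v ≺ u ⟧ ≡ pairs R
    reversed = trans (∑-swap V V (λ u v → ⟦ R u v ∧ v ≺ u ⟧))
                     (∑-cong V (λ v → ∑-cong V (λ u → cong (λ r → ⟦ r ∧ v ≺ u ⟧) (R-sym u v))))

-- Classes B and D have k + 1
-- vertices each, b and d of them on the near side, b′ and d′ on the far side;
-- e counts the B–D edges on the far side.  A far B-vertex has ≥ k neighbours
-- in D, at most d of them near, so e ≥ b′(k ∸ d); symmetrically e ≥ d′(k ∸ b).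
-- Then k(b + d) + e ≥ k(k + 1): use the second bound if b = 0, else the first.
sideBound : ∀ k b b′ d d′ e → b + b′ ≡ suc k → d + d′ ≡ suc k →
  b′ * (k ∸ d) ≤ e → d′ * (k ∸ b) ≤ e → k * suc k ≤ k * (b + d) + e
sideBound k zero b′ d d′ e _ d+d′ _ d′-bound = begin
  k * suc k      ≡⟨ cong (k *_) (≡-sym d+d′) ⟩
  k * (d + d′)   ≡⟨ *-distribˡ-+ k d d′ ⟩
  k * d + k * d′ ≡⟨ cong (k * d +_) (*-comm k d′) ⟩
  k * d + d′ * k ≤⟨ +-monoʳ-≤ (k * d) d′-bound ⟩
  k * d + e      ∎
  where open ≤-Reasoning
sideBound k (suc x) b′ d d′ e b+b′ _ b′-bound _ = begin
  k * suc k                              ≡⟨ *-suc k k ⟩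
  k + k * k                              ≤⟨ +-monoʳ-≤ k (*-monoʳ-≤ k (m≤n+m∸n k d)) ⟩
  k + k * (d + r)                        ≡⟨ cong (k +_) (*-distribˡ-+ k d r) ⟩
  k + (k * d + k * r)                    ≡⟨ cong (λ m → k + (k * d + m * r)) (≡-sym x+b′) ⟩
  k + (k * d + (x + b′) * r)             ≡⟨ expand k d x b′ r ⟩
  k + k * d + x * r + b′ * r             ≤⟨ +-monoˡ-≤ (b′ * r) (+-monoʳ-≤ (k + k * d) (*-monoʳ-≤ x (m∸n≤m k d))) ⟩
  k + k * d + x * k + b′ * r             ≡⟨ collect k d x (b′ * r) ⟩
  k * (suc x + d) + b′ * r               ≤⟨ +-monoʳ-≤ (k * (suc x + d)) b′-bound ⟩
  k * (suc x + d) + e                    ∎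
  where
  open ≤-Reasoning
  r : ℕ
  r = k ∸ d
  x+b′ : x + b′ ≡ k
  x+b′ = suc-injective b+b′
  expand : ∀ k d x b′ r → k + (k * d + (x + b′) * r) ≡ k + k * d + x * r + b′ * r
  expand = solve-∀
  collect : ∀ k d x e → k + k * d + x * k + e ≡ k * (suc x + d) + e
  collect = solve-∀

mixBound : ∀ aT aF s s′ → s ≤ s′ → (aT + aF) * s ≤ aT * s + aF * s′
mixBound aT aF s s′ s≤s′ = begin
  (aT + aF) * s   ≡⟨ *-distribʳ-+ s aT aF ⟩
  aT * s + aF * s ≤⟨ +-monoʳ-≤ (aT * s) (*-monoʳ-≤ aF s≤s′) ⟩
  aT * s + aF * s′ ∎
  where open ≤-Reasoning

-- Classes A, B, D of sizes k, k + 1,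
-- k + 1 are split between two sides T and F (aT + aF = k, …); A is complete to
-- B ∪ D, the B–D edges inside side T (resp. F) number eT (resp. eF), and the
-- degree condition gives the four lower bounds on eT and eF.  Then the number
-- aT(bT + dT) + aF(bF + dF) + eT + eF of edges inside the sides is ≥ k(k + 1):
-- apply sideBound, taking as near side the one with the smaller part of B ∪ D.
bipartitionBound : ∀ k aT aF bT bF dT dF eT eF →
  aT + aF ≡ k → bT + bF ≡ suc k → dT + dF ≡ suc k →
  bT * (k ∸ dF) ≤ eT → dT * (k ∸ bF) ≤ eT → bF * (k ∸ dT) ≤ eF → dF * (k ∸ bT) ≤ eF →
  k * suc k ≤ aT * (bT + dT) + aF * (bF + dF) + eT + eF
bipartitionBound k aT aF bT bF dT dF eT eF a b d eT₁ eT₂ eF₁ eF₂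
  with ≤-total (bT + dT) (bF + dF)
... | inj₁ sT≤sF = begin
  k * suc k                                ≤⟨ sideBound k bT bF dT dF eF b d eF₁ eF₂ ⟩
  k * (bT + dT) + eF                       ≡⟨ cong (λ m → m * (bT + dT) + eF) (≡-sym a) ⟩
  (aT + aF) * (bT + dT) + eF               ≤⟨ +-monoˡ-≤ eF (mixBound aT aF _ _ sT≤sF) ⟩
  aT * (bT + dT) + aF * (bF + dF) + eF     ≤⟨ +-monoˡ-≤ eF (m≤m+n _ eT) ⟩
  aT * (bT + dT) + aF * (bF + dF) + eT + eF ∎
  where open ≤-Reasoning
... | inj₂ sF≤sT = begin
  k * suc k                                ≤⟨ sideBound k bF bT dF dT eT (trans (+-comm bF bT) b)
                                                                         (trans (+-comm dF dT) d) eT₁ eT₂ ⟩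
  k * (bF + dF) + eT                       ≡⟨ cong (λ m → m * (bF + dF) + eT) (trans (≡-sym a) (+-comm aT aF)) ⟩
  (aF + aT) * (bF + dF) + eT               ≤⟨ +-monoˡ-≤ eT (mixBound aF aT _ _ sF≤sT) ⟩
  aF * (bF + dF) + aT * (bT + dT) + eT     ≤⟨ +-monoʳ-≤ _ (m≤m+n eT eF) ⟩
  aF * (bF + dF) + aT * (bT + dT) + (eT + eF) ≡⟨ reorder (aF * (bF + dF)) (aT * (bT + dT)) eT eF ⟩
  aT * (bT + dT) + aF * (bF + dF) + eT + eF ∎
  where
  open ≤-Reasoning
  reorder : ∀ p q s t → p + q + (s + t) ≡ q + p + s + t
  reorder = solve-∀

exhaust : ∀ (a b d : Fin 3) → a ≢ b → a ≢ d → b ≢ d → ∀ x → x ≡ a ⊎ x ≡ b ⊎ x ≡ d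
exhaust = toWitness {a? = check} tt
  where
  check : Dec (∀ (a b d : Fin 3) → a ≢ b → a ≢ d → b ≢ d → ∀ x → x ≡ a ⊎ x ≡ b ⊎ x ≡ d)
  check = all? λ a → all? λ b → all? λ d → ¬? (a ≟ b) →-dec ¬? (a ≟ d) →-dec ¬? (b ≟ d) →-dec
            all? λ x → x ≟ a ⊎-dec x ≟ b ⊎-dec x ≟ d

edge⇒2≤χ : ∀ {n} (H : Graph n) u v → adj H u v ≡ true → ∀ m → Colorable H m → 2 ≤ m
edge⇒2≤χ H u v uv zero (f , _) with f u
... | ()
edge⇒2≤χ H u v uv (suc zero) (f , proper) with f u | f v | proper u v uv
... | zero | zero | f-differs = ⊥-elim (f-differs refl)
edge⇒2≤χ H u v uv (suc (suc m)) _ = s≤s (s≤s z≤n)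

module ColourClasses {n : ℕ} (c : Fin n → Fin 3) where

  is : Fin 3 → Fin n → Bool
  is j v = does (c v ≟ j)

  is-true : ∀ {j v} → c v ≡ j → is j v ≡ true
  is-true {j} {v} = dec-true (c v ≟ j)

  is-false : ∀ {j v} → c v ≢ j → is j v ≡ false
  is-false {j} {v} = dec-false (c v ≟ j)

  is-other : ∀ {j j′ v} → c v ≡ j → j ≢ j′ → is j′ v ≡ false
  is-other v∈j j≢j′ = is-false (λ v∈j′ → j≢j′ (trans (≡-sym v∈j) v∈j′))

  is-sound : ∀ j v → is j v ≡ true → c v ≡ j
  is-sound j v with c v ≟ j
  ... | yes cv≡j = λ _ → cv≡j
  ... | no _ = λ ()

  classSize≡∑ : ∀ j → classSize c j ≡ ∑[ v ∈ allFin n ] ⟦ is j v ⟧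
  classSize≡∑ j = length-filter (λ v → c v ≟ j) (allFin n)

module UpperBound {n : ℕ} (G : Graph n) (c : Fin n → Fin 3) (proper : IsProperColoring G c)
  (a b d : Fin 3) (a≢b : a ≢ b) (a≢d : a ≢ d) (b≢d : b ≢ d)
  (A–B : ∀ u w → c u ≡ a → c w ≡ b → adj G u w ≡ true) where

  open ColourClasses c
  open PairCounts {n}

  meetsD : Rel
  meetsD u v = is d u ∨ is d v

  meetsD-sym : ∀ u v → meetsD u v ≡ meetsD v u
  meetsD-sym u v = ∨-comm (is d u) (is d v)

  -- The edges of G meeting D; since c is proper, these are all edges but the A–B ones.
  G−AB : Graph n
  G−AB = record
    { adj = λ u v → meetsD u v ∧ adj G u v
    ; sym = λ u v → cong₂ _∧_ (meetsD-sym u v) (Graph.sym G u v)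
    ; irrefl = λ v → trans (cong (meetsD v v ∧_) (Graph.irrefl G v)) (∧-zeroʳ (meetsD v v)) }

  G−AB⊆G : G−AB ⊆G G
  G−AB⊆G u v = ∧-conicalʳ (meetsD u v) (adj G u v)

  inD : Fin n → Fin 2
  inD v = if is d v then suc zero else zero

  inD-proper : IsProperColoring G−AB inD
  inD-proper u v with c u ≟ d | c v ≟ d
  ... | yes u∈D | yes v∈D = λ uv _ → proper u v (∧-conicalʳ true (adj G u v) uv) (trans u∈D (≡-sym v∈D))
  ... | yes _ | no _ = λ _ ()
  ... | no _ | yes _ = λ _ ()
  ... | no _ | no _ = λ ()

  -- An edge of G into D survives the deletion, so G−AB still needs two colours.
  χ[G−AB]≡2 : ∀ u v → c v ≡ d → adj G u v ≡ true → IsChi G−AB 2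
  χ[G−AB]≡2 u v v∈D uv = (inD , inD-proper) , edge⇒2≤χ G−AB u v survives
    where
    survives : meetsD u v ∧ adj G u v ≡ true
    survives rewrite is-true v∈D | ∨-zeroʳ (is d u) = uv

  -- The deleted pairs coincide with the A–B pairs: a G-edge avoiding D joins
  -- two of A and B, which must differ as c is proper; conversely A–B pairs
  -- are edges by completeness.
  removed : Rel
  removed u v = not (meetsD u v) ∧ adj G u v

  cross : Rel
  cross u v = (is a u ∧ is b v) ∨ (is b u ∧ is a v)

  removed-sym : ∀ u v → removed u v ≡ removed v u
  removed-sym u v = cong₂ _∧_ (cong not (meetsD-sym u v)) (Graph.sym G u v)

  removed-irrefl : ∀ v → removed v v ≡ false
  removed-irrefl v = trans (cong (not (meetsD v v) ∧_) (Graph.irrefl G v)) (∧-zeroʳ _)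

  AB⇒removed : ∀ {u v} → c u ≡ a → c v ≡ b → removed u v ≡ true
  AB⇒removed {u} {v} u∈A v∈B
    rewrite is-other {v = u} u∈A a≢d | is-other {v = v} v∈B b≢d = A–B u v u∈A v∈B

  cross⇒removed : ∀ u v → cross u v ≡ true → removed u v ≡ true
  cross⇒removed u v with is a u ∧ is b v in uv∈AB
  ... | true = λ _ → AB⇒removed (is-sound a u (∧-conicalˡ _ _ uv∈AB)) (is-sound b v (∧-conicalʳ _ _ uv∈AB))
  ... | false = λ uv∈BA →
    trans (removed-sym u v) (AB⇒removed (is-sound a v (∧-conicalʳ _ _ uv∈BA)) (is-sound b u (∧-conicalˡ _ _ uv∈BA)))

  removed⇒cross : ∀ u v → removed u v ≡ true → cross u v ≡ true
  removed⇒cross u v with exhaust a b d a≢b a≢d b≢d (c u) | exhaust a b d a≢b a≢d b≢d (c v)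
  ... | inj₂ (inj₂ u∈D) | _ rewrite is-true u∈D = λ ()
  ... | _ | inj₂ (inj₂ v∈D) rewrite is-true v∈D | ∨-zeroʳ (is d u) = λ ()
  ... | inj₁ u∈A | inj₁ v∈A = λ uv → ⊥-elim (proper u v (∧-conicalʳ _ _ uv) (trans u∈A (≡-sym v∈A)))
  ... | inj₂ (inj₁ u∈B) | inj₂ (inj₁ v∈B) = λ uv → ⊥-elim (proper u v (∧-conicalʳ _ _ uv) (trans u∈B (≡-sym v∈B)))
  ... | inj₁ u∈A | inj₂ (inj₁ v∈B) rewrite is-true u∈A | is-true v∈B = λ _ → refl
  ... | inj₂ (inj₁ u∈B) | inj₁ v∈A rewrite is-true u∈B | is-true v∈A | ∨-zeroʳ (is a u ∧ is b v) = λ _ → refl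

  removed≡cross : ∀ u v → removed u v ≡ cross u v
  removed≡cross u v = bool-ext (removed⇒cross u v) (cross⇒removed u v)

  ⟦cross⟧ : ∀ u v → ⟦ cross u v ⟧ ≡ ⟦ is a u ⟧ * ⟦ is b v ⟧ + ⟦ is b u ⟧ * ⟦ is a v ⟧
  ⟦cross⟧ u v = trans (⟦∨⟧ _ _ incompatible) (cong₂ _+_ (⟦∧⟧ (is a u) (is b v)) (⟦∧⟧ (is b u) (is a v)))
    where
    incompatible : is a u ∧ is b v ≡ true → is b u ∧ is a v ≡ true → ⊥
    incompatible uv∈AB uv∈BA =
      a≢b (trans (≡-sym (is-sound a u (∧-conicalˡ _ _ uv∈AB))) (is-sound b u (∧-conicalˡ _ _ uv∈BA)))

  deleted-count : edgeCount G ∸ edgeCount G−AB ≡ classSize c a * classSize c b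
  deleted-count = begin
    edgeCount G ∸ edgeCount G−AB                    ≡⟨ cong (_∸ edgeCount G−AB) (pairs-split (adj G) meetsD) ⟩
    edgeCount G−AB + pairs removed ∸ edgeCount G−AB ≡⟨ m+n∸m≡n (edgeCount G−AB) (pairs removed) ⟩
    pairs removed                                   ≡⟨ *-cancelˡ-≡ _ _ 2 doubled ⟩
    classSize c a * classSize c b                   ∎
    where
    open ≡-Reasoning
    ∣A∣ ∣B∣ : ℕ
    ∣A∣ = classSize c a
    ∣B∣ = classSize c b
    doubled : 2 * pairs removed ≡ 2 * (∣A∣ * ∣B∣)
    doubled = begin
      2 * pairs removed
        ≡⟨ ≡-sym (handshake removed removed-sym removed-irrefl) ⟩
      ∑[ u ∈ V ] ∑[ v ∈ V ] ⟦ removed u v ⟧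
        ≡⟨ ∑-cong V (λ u → ∑-cong V (λ v → trans (cong ⟦_⟧ (removed≡cross u v)) (⟦cross⟧ u v))) ⟩
      ∑[ u ∈ V ] ∑[ v ∈ V ] (⟦ is a u ⟧ * ⟦ is b v ⟧ + ⟦ is b u ⟧ * ⟦ is a v ⟧)
        ≡⟨ trans (∑-cong V (λ u → ∑-+ V _ _)) (∑-+ V _ _) ⟩
      ∑[ u ∈ V ] ∑[ v ∈ V ] (⟦ is a u ⟧ * ⟦ is b v ⟧) + ∑[ u ∈ V ] ∑[ v ∈ V ] (⟦ is b u ⟧ * ⟦ is a v ⟧)
        ≡⟨ cong₂ _+_ (∑-product V V (λ u → ⟦ is a u ⟧) (λ v → ⟦ is b v ⟧))
                     (∑-product V V (λ u → ⟦ is b u ⟧) (λ v → ⟦ is a v ⟧)) ⟩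
      ∑[ v ∈ V ] ⟦ is a v ⟧ * ∑[ v ∈ V ] ⟦ is b v ⟧ + ∑[ v ∈ V ] ⟦ is b v ⟧ * ∑[ v ∈ V ] ⟦ is a v ⟧
        ≡⟨ cong₂ (λ x y → x * y + y * x) (≡-sym (classSize≡∑ a)) (≡-sym (classSize≡∑ b)) ⟩
      ∣A∣ * ∣B∣ + ∣B∣ * ∣A∣
        ≡⟨ double ∣A∣ ∣B∣ ⟩
      2 * (∣A∣ * ∣B∣) ∎
      where
      double : ∀ x y → x * y + y * x ≡ 2 * (x * y)
      double = solve-∀

_==_ : Bool → Bool → Bool
true == y = y
false == y = not y

==-sym : ∀ x y → (x == y) ≡ (y == x)
==-sym false false = refl
==-sym false true = refl
==-sym true false = refl
==-sym true true = refl

==-sound : ∀ x y → (x == y) ≡ true → x ≡ y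
==-sound false false _ = refl
==-sound true true _ = refl

side : ∀ {m} → Fin m → Bool
side zero = true
side (suc _) = false

side-injective : ∀ {m} → m ≤ 2 → (x y : Fin m) → side x ≡ side y → x ≡ y
side-injective _ zero zero _ = refl
side-injective _ zero (suc _) ()
side-injective _ (suc _) zero ()
side-injective _ (suc zero) (suc zero) _ = refl
side-injective {suc (suc (suc _))} (s≤s (s≤s ())) (suc zero) (suc (suc _)) _
side-injective {suc (suc (suc _))} (s≤s (s≤s ())) (suc (suc _)) (suc _) _

colouring-sides : ∀ {n m} (H : Graph n) (f : Fin n → Fin m) → m ≤ 2 → IsProperColoring H f →
  ∀ u v → adj H u v ≡ true → side (f u) ≢ side (f v)
colouring-sides H f m≤2 f-proper u v uv = f-proper u v uv ∘ side-injective m≤2 (f u) (f v)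

lost-edges : ∀ {n} (G H : Graph n) → H ⊆G G → (sd : Fin n → Bool) →
  (∀ u v → adj H u v ≡ true → sd u ≢ sd v) →
  PairCounts.pairs (λ u v → (sd u == sd v) ∧ adj G u v) ≤ edgeCount G ∸ edgeCount H
lost-edges {n} G H H⊆G sd H-across = m+n≤o⇒m≤o∸n (pairs same) (begin
  pairs same + edgeCount H  ≤⟨ +-monoʳ-≤ (pairs same) (pairs-mono (adj H) different H-edge-different) ⟩
  pairs same + pairs different ≡⟨ ≡-sym (pairs-split (adj G) (λ u v → sd u == sd v)) ⟩
  edgeCount G ∎)
  where
  open PairCounts {n}
  open ≤-Reasoning
  same different : Rel
  same u v = (sd u == sd v) ∧ adj G u v
  different u v = not (sd u == sd v) ∧ adj G u v
  H-edge-different : ∀ u v → adj H u v ≡ true → different u v ≡ true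
  H-edge-different u v uv with sd u == sd v in eq
  ... | true = ⊥-elim (H-across u v uv (==-sound (sd u) (sd v) eq))
  ... | false = H⊆G u v uv

-- Lower bound: every bipartition sd of V(G) has at least k(k + 1) edges of G
-- inside its sides.  The same-side degree of each vertex is bounded below;
-- summing over the vertices counts each such edge twice, and
-- bipartitionBound finishes the estimate.
module SameSideCount {n : ℕ} (G : Graph n) (c : Fin n → Fin 3)
  (a b d : Fin 3) (a≢b : a ≢ b) (a≢d : a ≢ d) (b≢d : b ≢ d)
  (A–B : ∀ u w → c u ≡ a → c w ≡ b → adj G u w ≡ true)
  (A–D : ∀ u w → c u ≡ a → c w ≡ d → adj G u w ≡ true)
  (k : ℕ) (degree : ∀ v j → j ≢ c v → k ≤ eToClass G c v j)
  (∣A∣ : classSize c a ≡ k) (∣B∣ : classSize c b ≡ suc k) (∣D∣ : classSize c d ≡ suc k)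
  (sd : Fin n → Bool) where

  open ColourClasses c
  open PairCounts {n}

  on : Bool → Fin n → ℕ
  on σ v = ⟦ σ == sd v ⟧

  col : Fin 3 → Fin n → ℕ
  col j v = ⟦ is j v ⟧

  edge : Fin n → Fin n → ℕ
  edge u v = ⟦ adj G u v ⟧

  N : Fin 3 → Bool → ℕ
  N j σ = ∑[ v ∈ V ] (on σ v * col j v)

  nbrs : Fin 3 → Bool → Fin n → ℕ
  nbrs j σ u = ∑[ v ∈ V ] (on σ v * (edge u v * col j v))

  sameDeg : Fin n → ℕ
  sameDeg u = ∑[ v ∈ V ] ⟦ (sd u == sd v) ∧ adj G u v ⟧

  side-partition : ∀ v → on true v + on false v ≡ 1
  side-partition v with sd v
  ... | true = refl
  ... | false = refl

  colour-partition : ∀ v → col a v + col b v + col d v ≡ 1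
  colour-partition v with exhaust a b d a≢b a≢d b≢d (c v)
  ... | inj₁ v∈A rewrite is-true v∈A | is-other v∈A a≢b | is-other v∈A a≢d = refl
  ... | inj₂ (inj₁ v∈B) rewrite is-other v∈B (≢-sym a≢b) | is-true v∈B | is-other v∈B b≢d = refl
  ... | inj₂ (inj₂ v∈D) rewrite is-other v∈D (≢-sym a≢d) | is-other v∈D (≢-sym b≢d) | is-true v∈D = refl

  colour-disjoint : ∀ {j j′} → j ≢ j′ → ∀ v → col j v + col j′ v ≤ 1
  colour-disjoint {j} {j′} j≢j′ v with c v ≟ j | c v ≟ j′
  ... | yes v∈j | yes v∈j′ = ⊥-elim (j≢j′ (trans (≡-sym v∈j) v∈j′))
  ... | yes _ | no _ = ≤-refl
  ... | no _ | yes _ = ≤-refl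
  ... | no _ | no _ = z≤n

  side-split : ∀ v x → on true v * x + on false v * x ≡ x
  side-split v x = trans (≡-sym (*-distribʳ-+ x (on true v) (on false v)))
                         (trans (cong (_* x) (side-partition v)) (*-identityˡ x))

  class-split : ∀ j → classSize c j ≡ N j true + N j false
  class-split j = trans (classSize≡∑ j)
    (trans (∑-cong V (λ v → ≡-sym (side-split v (col j v)))) (∑-+ V _ _))

  degree-split : ∀ u j → eToClass G c u j ≡ nbrs j true u + nbrs j false u
  degree-split u j = trans (length-filter² (λ w → adj G u w Bool.≟ true) (λ w → c w ≟ j) V)
    (trans (∑-cong V pointwise) (∑-+ V _ _))
    where
    is-edge : ∀ x → does (x Bool.≟ true) ≡ x
    is-edge false = refl
    is-edge true = refl
    pointwise : ∀ v → ⟦ does (adj G u v Bool.≟ true) ∧ is j v ⟧ ≡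
                      on true v * (edge u v * col j v) + on false v * (edge u v * col j v)
    pointwise v = trans (cong (λ x → ⟦ x ∧ is j v ⟧) (is-edge (adj G u v)))
                        (trans (⟦∧⟧ (adj G u v) (is j v)) (≡-sym (side-split v _)))

  nbrs≤N : ∀ j σ u → nbrs j σ u ≤ N j σ
  nbrs≤N j σ u = ∑-mono V (λ v → *-monoʳ-≤ (on σ v) (⟦⟧*-≤ (adj G u v) (col j v)))

  -- The degree condition, seen from one side: of the ≥ k neighbours of u in C_j
  -- at most N j (not σ) lie on the other side.
  degree-on-side : ∀ σ u j → j ≢ c u → k ∸ N j (not σ) ≤ nbrs j σ u
  degree-on-side σ u j j≢cu = m≤n+o⇒m∸n≤o k (N j (not σ)) (begin
    k                                    ≤⟨ degree u j j≢cu ⟩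
    eToClass G c u j                     ≡⟨ both-sides σ ⟩
    nbrs j (not σ) u + nbrs j σ u        ≤⟨ +-monoˡ-≤ (nbrs j σ u) (nbrs≤N j (not σ) u) ⟩
    N j (not σ) + nbrs j σ u             ∎)
    where
    open ≤-Reasoning
    both-sides : ∀ σ → eToClass G c u j ≡ nbrs j (not σ) u + nbrs j σ u
    both-sides true = trans (degree-split u j) (+-comm (nbrs j true u) (nbrs j false u))
    both-sides false = degree-split u j

  complete⇒nbrs≡N : ∀ j σ u → (∀ v → c v ≡ j → adj G u v ≡ true) → nbrs j σ u ≡ N j σ
  complete⇒nbrs≡N j σ u complete = ∑-cong V (λ v → cong (on σ v *_) (pointwise v))
    where
    pointwise : ∀ v → edge u v * col j v ≡ col j v
    pointwise v with c v ≟ j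
    ... | yes v∈j rewrite complete v v∈j = refl
    ... | no _ = *-zeroʳ (edge u v)

  nbrs-disjoint : ∀ {j j′} → j ≢ j′ → ∀ σ u →
    nbrs j σ u + nbrs j′ σ u ≤ ∑[ v ∈ V ] (on σ v * edge u v)
  nbrs-disjoint {j} {j′} j≢j′ σ u = begin
    nbrs j σ u + nbrs j′ σ u               ≡⟨ ≡-sym (∑-+ V _ _) ⟩
    ∑[ v ∈ V ] (on σ v * (edge u v * col j v) + on σ v * (edge u v * col j′ v))
      ≡⟨ ∑-cong V (λ v → factor (on σ v) (edge u v) (col j v) (col j′ v)) ⟩
    ∑[ v ∈ V ] (on σ v * (edge u v * (col j v + col j′ v)))
      ≤⟨ ∑-mono V (λ v → *-monoʳ-≤ (on σ v) (*-monoʳ-≤ (edge u v) (colour-disjoint j≢j′ v))) ⟩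
    ∑[ v ∈ V ] (on σ v * (edge u v * 1))    ≡⟨ ∑-cong V (λ v → cong (on σ v *_) (*-identityʳ (edge u v))) ⟩
    ∑[ v ∈ V ] (on σ v * edge u v)         ∎
    where
    open ≤-Reasoning
    factor : ∀ o e x y → o * (e * x) + o * (e * y) ≡ o * (e * (x + y))
    factor = solve-∀

  sameDeg-on-side : ∀ σ u → sd u ≡ σ → sameDeg u ≡ ∑[ v ∈ V ] (on σ v * edge u v)
  sameDeg-on-side _ u refl = ∑-cong V (λ v → ⟦∧⟧ (sd u == sd v) (adj G u v))

  A-vertex : ∀ σ u → c u ≡ a → sd u ≡ σ → N b σ + N d σ ≤ sameDeg u
  A-vertex σ u u∈A u∈σ = begin
    N b σ + N d σ             ≡⟨ ≡-sym (cong₂ _+_ (complete⇒nbrs≡N b σ u (λ v → A–B u v u∈A))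
                                                  (complete⇒nbrs≡N d σ u (λ v → A–D u v u∈A))) ⟩
    nbrs b σ u + nbrs d σ u   ≤⟨ nbrs-disjoint b≢d σ u ⟩
    ∑[ v ∈ V ] (on σ v * edge u v) ≡⟨ ≡-sym (sameDeg-on-side σ u u∈σ) ⟩
    sameDeg u                 ∎
    where open ≤-Reasoning

  B-vertex : ∀ σ u → c u ≡ b → sd u ≡ σ → N a σ + nbrs d σ u ≤ sameDeg u
  B-vertex σ u u∈B u∈σ = begin
    N a σ + nbrs d σ u        ≡⟨ ≡-sym (cong (_+ nbrs d σ u) (complete⇒nbrs≡N a σ u
                                   (λ v v∈A → trans (Graph.sym G u v) (A–B v u v∈A u∈B)))) ⟩
    nbrs a σ u + nbrs d σ u   ≤⟨ nbrs-disjoint a≢d σ u ⟩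
    ∑[ v ∈ V ] (on σ v * edge u v) ≡⟨ ≡-sym (sameDeg-on-side σ u u∈σ) ⟩
    sameDeg u                 ∎
    where open ≤-Reasoning

  D-vertex : ∀ σ u → c u ≡ d → sd u ≡ σ → N a σ + nbrs b σ u ≤ sameDeg u
  D-vertex σ u u∈D u∈σ = begin
    N a σ + nbrs b σ u        ≡⟨ ≡-sym (cong (_+ nbrs b σ u) (complete⇒nbrs≡N a σ u
                                   (λ v v∈A → trans (Graph.sym G u v) (A–D v u v∈A u∈D)))) ⟩
    nbrs a σ u + nbrs b σ u   ≤⟨ nbrs-disjoint a≢b σ u ⟩
    ∑[ v ∈ V ] (on σ v * edge u v) ≡⟨ ≡-sym (sameDeg-on-side σ u u∈σ) ⟩
    sameDeg u                 ∎
    where open ≤-Reasoning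

  forcedAt : Bool → Fin n → ℕ
  forcedAt σ u = col a u * (N b σ + N d σ) + col b u * (N a σ + nbrs d σ u) + col d u * (N a σ + nbrs b σ u)

  -- Case analysis on the colour of u, phrased as a partition of unity.
  forcedAt-≤ : ∀ σ u → sd u ≡ σ → forcedAt σ u ≤ sameDeg u
  forcedAt-≤ σ u u∈σ = partition₃ (col a u) (col b u) (col d u) (colour-partition u)
    (weighted (is a u) (λ e → A-vertex σ u (is-sound a u e) u∈σ))
    (weighted (is b u) (λ e → B-vertex σ u (is-sound b u e) u∈σ))
    (weighted (is d u) (λ e → D-vertex σ u (is-sound d u e) u∈σ))

  forced-≤ : ∀ u → on true u * forcedAt true u + on false u * forcedAt false u ≤ sameDeg u
  forced-≤ u = partition₂ (on true u) (on false u) (side-partition u)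
    (weighted (true == sd u) (λ e → forcedAt-≤ true u (≡-sym (==-sound true (sd u) e))))
    (weighted (false == sd u) (λ e → forcedAt-≤ false u (≡-sym (==-sound false (sd u) e))))

  E : Fin 3 → Fin 3 → Bool → ℕ
  E j j′ σ = ∑[ u ∈ V ] (on σ u * (col j u * nbrs j′ σ u))

  E-double : ∀ j j′ σ → E j j′ σ ≡ ∑[ u ∈ V ] ∑[ v ∈ V ] (on σ u * col j u * (on σ v * col j′ v) * edge u v)
  E-double j j′ σ = ∑-cong V λ u → begin
    on σ u * (col j u * nbrs j′ σ u)
      ≡⟨ cong (on σ u *_) (≡-sym (∑-*ˡ V (col j u) _)) ⟩
    on σ u * ∑[ v ∈ V ] (col j u * (on σ v * (edge u v * col j′ v)))
      ≡⟨ ≡-sym (∑-*ˡ V (on σ u) _) ⟩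
    ∑[ v ∈ V ] (on σ u * (col j u * (on σ v * (edge u v * col j′ v))))
      ≡⟨ ∑-cong V (λ v → regroup (on σ u) (col j u) (on σ v) (edge u v) (col j′ v)) ⟩
    ∑[ v ∈ V ] (on σ u * col j u * (on σ v * col j′ v) * edge u v) ∎
    where
    open ≡-Reasoning
    regroup : ∀ o x o′ e y → o * (x * (o′ * (e * y))) ≡ o * x * (o′ * y) * e
    regroup = solve-∀

  E-sym : ∀ j j′ σ → E j j′ σ ≡ E j′ j σ
  E-sym j j′ σ = begin
    E j j′ σ
      ≡⟨ E-double j j′ σ ⟩
    ∑[ u ∈ V ] ∑[ v ∈ V ] (on σ u * col j u * (on σ v * col j′ v) * edge u v)
      ≡⟨ ∑-swap V V _ ⟩
    ∑[ v ∈ V ] ∑[ u ∈ V ] (on σ u * col j u * (on σ v * col j′ v) * edge u v)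
      ≡⟨ ∑-cong V (λ v → ∑-cong V (λ u →
           cong₂ _*_ (*-comm (on σ u * col j u) (on σ v * col j′ v)) (cong ⟦_⟧ (Graph.sym G u v)))) ⟩
    ∑[ v ∈ V ] ∑[ u ∈ V ] (on σ v * col j′ v * (on σ u * col j u) * edge v u)
      ≡⟨ ≡-sym (E-double j′ j σ) ⟩
    E j′ j σ ∎
    where open ≡-Reasoning

  E-lower : ∀ j j′ σ → j′ ≢ j → N j σ * (k ∸ N j′ (not σ)) ≤ E j j′ σ
  E-lower j j′ σ j′≢j = begin
    N j σ * K                           ≡⟨ ≡-sym (∑-*ʳ V K _) ⟩
    ∑[ u ∈ V ] (on σ u * col j u * K)   ≡⟨ ∑-cong V (λ u → *-assoc (on σ u) (col j u) K) ⟩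
    ∑[ u ∈ V ] (on σ u * (col j u * K)) ≤⟨ ∑-mono V (λ u → *-monoʳ-≤ (on σ u) (weighted (is j u) (in-C_j u))) ⟩
    E j j′ σ                            ∎
    where
    open ≤-Reasoning
    K : ℕ
    K = k ∸ N j′ (not σ)
    in-C_j : ∀ u → is j u ≡ true → K ≤ nbrs j′ σ u
    in-C_j u u∈j = degree-on-side σ u j′ (λ j′≡cu → j′≢j (trans j′≡cu (is-sound j u u∈j)))

  -- Summing the forced degrees over the vertices of side σ counts the edges
  -- inside σ from A to B ∪ D twice and the B–D edges inside σ twice.
  forced-sum : ∀ σ → ∑[ u ∈ V ] (on σ u * forcedAt σ u) ≡
    N a σ * (N b σ + N d σ) + N b σ * N a σ + N d σ * N a σ + (E b d σ + E b d σ)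
  forced-sum σ = begin
    ∑[ u ∈ V ] (on σ u * forcedAt σ u)
      ≡⟨ ∑-cong V (λ u → expand (on σ u) (col a u) (col b u) (col d u) X Y (nbrs d σ u) (nbrs b σ u)) ⟩
    ∑[ u ∈ V ] (on σ u * col a u * X + on σ u * col b u * Y + on σ u * col d u * Y
                + (on σ u * (col b u * nbrs d σ u) + on σ u * (col d u * nbrs b σ u)))
      ≡⟨ trans (∑-+ V _ _) (cong₂ _+_ (trans (∑-+ V _ _) (cong (_+ ∑[ u ∈ V ] (on σ u * col d u * Y)) (∑-+ V _ _)))
                                      (∑-+ V _ _)) ⟩
    ∑[ u ∈ V ] (on σ u * col a u * X) + ∑[ u ∈ V ] (on σ u * col b u * Y) + ∑[ u ∈ V ] (on σ u * col d u * Y)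
      + (E b d σ + E d b σ)
      ≡⟨ cong (_+ (E b d σ + E d b σ)) (cong₂ _+_ (cong₂ _+_ (∑-*ʳ V X _) (∑-*ʳ V Y _)) (∑-*ʳ V Y _)) ⟩
    N a σ * X + N b σ * Y + N d σ * Y + (E b d σ + E d b σ)
      ≡⟨ cong (λ e → N a σ * X + N b σ * Y + N d σ * Y + (E b d σ + e)) (E-sym d b σ) ⟩
    N a σ * X + N b σ * Y + N d σ * Y + (E b d σ + E b d σ) ∎
    where
    open ≡-Reasoning
    X Y : ℕ
    X = N b σ + N d σ
    Y = N a σ
    expand : ∀ o x y z X Y r s →
      o * (x * X + y * (Y + r) + z * (Y + s)) ≡ o * x * X + o * y * Y + o * z * Y + (o * (y * r) + o * (z * s))
    expand = solve-∀

  sameSide : Rel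
  sameSide u v = (sd u == sd v) ∧ adj G u v

  sameSide-bound : k * suc k ≤ pairs sameSide
  sameSide-bound = *-cancelˡ-≤ 2 (begin
    2 * (k * suc k)
      ≤⟨ *-monoʳ-≤ 2 (bipartitionBound k aT aF bT bF dT dF eT eF
           (sizes a ∣A∣) (sizes b ∣B∣) (sizes d ∣D∣) eT-from-B eT-from-D eF-from-B eF-from-D) ⟩
    2 * (aT * (bT + dT) + aF * (bF + dF) + eT + eF)
      ≡⟨ regroup aT bT dT eT aF bF dF eF ⟩
    (aT * (bT + dT) + bT * aT + dT * aT + (eT + eT)) + (aF * (bF + dF) + bF * aF + dF * aF + (eF + eF))
      ≡⟨ ≡-sym (cong₂ _+_ (forced-sum true) (forced-sum false)) ⟩
    ∑[ u ∈ V ] (on true u * forcedAt true u) + ∑[ u ∈ V ] (on false u * forcedAt false u)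
      ≡⟨ ≡-sym (∑-+ V _ _) ⟩
    ∑[ u ∈ V ] (on true u * forcedAt true u + on false u * forcedAt false u)
      ≤⟨ ∑-mono V forced-≤ ⟩
    ∑[ u ∈ V ] sameDeg u
      ≡⟨ handshake sameSide (λ u v → cong₂ _∧_ (==-sym (sd u) (sd v)) (Graph.sym G u v))
           (λ v → trans (cong ((sd v == sd v) ∧_) (Graph.irrefl G v)) (∧-zeroʳ _)) ⟩
    2 * pairs sameSide ∎)
    where
    open ≤-Reasoning
    aT aF bT bF dT dF eT eF : ℕ
    aT = N a true
    aF = N a false
    bT = N b true
    bF = N b false
    dT = N d true
    dF = N d false
    eT = E b d true
    eF = E b d false
    sizes : ∀ j {s} → classSize c j ≡ s → N j true + N j false ≡ s
    sizes j ∣C∣ = trans (≡-sym (class-split j)) ∣C∣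
    eT-from-B : bT * (k ∸ dF) ≤ eT
    eT-from-B = E-lower b d true (≢-sym b≢d)
    eT-from-D : dT * (k ∸ bF) ≤ eT
    eT-from-D = subst (dT * (k ∸ bF) ≤_) (E-sym d b true) (E-lower d b true b≢d)
    eF-from-B : bF * (k ∸ dT) ≤ eF
    eF-from-B = E-lower b d false (≢-sym b≢d)
    eF-from-D : dF * (k ∸ bT) ≤ eF
    eF-from-D = subst (dF * (k ∸ bT) ≤_) (E-sym d b false) (E-lower d b false b≢d)
    regroup : ∀ aT bT dT eT aF bF dF eF →
      2 * (aT * (bT + dT) + aF * (bF + dF) + eT + eF) ≡
      (aT * (bT + dT) + bT * aT + dT * aT + (eT + eT)) + (aF * (bF + dF) + bF * aF + dF * aF + (eF + eF))
    regroup = solve-∀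

-- χ(G) is at most the order: colour every vertex differently.
χ≤order : ∀ {n} (G : Graph n) k → IsChi G k → k ≤ n
χ≤order {n} G k (_ , minimal) = minimal n (id , distinct)
  where
  distinct : IsProperColoring G id
  distinct u v uv refl = contradiction (trans (≡-sym uv) (Graph.irrefl G u)) λ ()

quotient-positive : ∀ n → n % 3 ≡ 2 → 3 ≤ n → 1 ≤ n / 3
quotient-positive n n%3≡2 3≤n with n / 3 | m≡m%n+[m/n]*n n 3
... | suc _ | _ = s≤s z≤n
... | zero | n≡n%3+0 with s≤s (s≤s ()) ← subst (3 ≤_) (trans n≡n%3+0 (cong (_+ 0) n%3≡2)) 3≤n

witness : ∀ {A : Set} {ℓ} {P : Pred A ℓ} (P? : Decidable P) xs → 1 ≤ length (filter P? xs) → Σ A P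
witness P? (x ∷ xs) nonempty with P? x
... | yes Px = x , Px
... | no _ = witness P? xs nonempty

record SortedColours (s : Fin 3 → ℕ) : Set where
  constructor sorted
  field
    a b d : Fin 3
    a≢b : a ≢ b
    a≢d : a ≢ d
    b≢d : b ≢ d
    a≤b : s a ≤ s b
    b≤d : s b ≤ s d

sortColours : (s : Fin 3 → ℕ) → SortedColours s
sortColours s
  with ≤-total (s zero) (s (suc zero))
     | ≤-total (s (suc zero)) (s (suc (suc zero)))
     | ≤-total (s zero) (s (suc (suc zero)))
... | inj₁ p | inj₁ q | _      = sorted zero (suc zero) (suc (suc zero)) (λ ()) (λ ()) (λ ()) p q
... | inj₁ p | inj₂ q | inj₁ r = sorted zero (suc (suc zero)) (suc zero) (λ ()) (λ ()) (λ ()) r q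
... | inj₁ p | inj₂ q | inj₂ r = sorted (suc (suc zero)) zero (suc zero) (λ ()) (λ ()) (λ ()) r p
... | inj₂ p | inj₁ q | inj₁ r = sorted (suc zero) zero (suc (suc zero)) (λ ()) (λ ()) (λ ()) p r
... | inj₂ p | inj₁ q | inj₂ r = sorted (suc zero) (suc (suc zero)) zero (λ ()) (λ ()) (λ ()) q r
... | inj₂ p | inj₂ q | _      = sorted (suc (suc zero)) (suc zero) zero (λ ()) (λ ()) (λ ()) q p

theorem4p2 : (n : ℕ) → (G : Graph n) → n % 3 ≡ 2 → IsChi G 3 →
    (∀ (c : Fin n → Fin 3) → IsProperColoring G c →
      ∀ (a b d : Fin 3) → a ≢ b → a ≢ d → b ≢ d →
      classSize c a ≤ classSize c b → classSize c b ≤ classSize c d →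
      ((classSize c a ≡ n / 3) × (classSize c b ≡ n / 3 + 1) × (classSize c d ≡ n / 3 + 1))
      × (∀ u w → c u ≡ a → c w ≡ b → adj G u w ≡ true)
      × (∀ u w → c u ≡ a → c w ≡ d → adj G u w ≡ true)
      × (∀ v j → j ≢ c v → n / 3 ≤ eToClass G c v j)) →
    IsEsChi G ((n / 3) * (n / 3 + 1))
theorem4p2 n G n%3≡2 χG≡3 structure
  with (c , c-proper) ← proj₁ χG≡3
  with sorted a b d a≢b a≢d b≢d ∣A∣≤∣B∣ ∣B∣≤∣D∣ ← sortColours (classSize c)
  with (∣A∣ , ∣B∣ , ∣D∣) , A–B , A–D , degree ← structure c c-proper a b d a≢b a≢d b≢d ∣A∣≤∣B∣ ∣B∣≤∣D∣
  = (G−AB , G−AB⊆G , χ-drops , trans deleted-count (cong₂ _*_ ∣A∣ ∣B∣)) , lower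
  where
  open UpperBound G c c-proper a b d a≢b a≢d b≢d A–B
  k : ℕ
  k = n / 3
  k≥1 : 1 ≤ k
  k≥1 = quotient-positive n n%3≡2 (χ≤order G 3 χG≡3)
  u₀∈A : Σ (Fin n) (λ v → c v ≡ a)
  u₀∈A = witness (λ v → c v ≟ a) (allFin n) (subst (1 ≤_) (≡-sym ∣A∣) k≥1)
  v₀∈D : Σ (Fin n) (λ v → c v ≡ d)
  v₀∈D = witness (λ v → c v ≟ d) (allFin n) (subst (1 ≤_) (≡-sym ∣D∣) (≤-trans k≥1 (m≤m+n k 1)))
  χ-drops : ChiSmaller G−AB G
  χ-drops m χG≡m =
    2 , χ[G−AB]≡2 _ _ (proj₂ v₀∈D) (A–D _ _ (proj₂ u₀∈A) (proj₂ v₀∈D)) , proj₂ χG≡3 m (proj₁ χG≡m)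
  lower : ∀ H → H ⊆G G → ChiSmaller H G → k * (k + 1) ≤ edgeCount G ∸ edgeCount H
  lower H H⊆G χH<χG with m , ((f , f-proper) , _) , m<3 ← χH<χG 3 χG≡3 =
    subst (λ s → k * s ≤ edgeCount G ∸ edgeCount H) (+-comm 1 k)
      (≤-trans (SameSideCount.sameSide-bound G c a b d a≢b a≢d b≢d A–B A–D k degree
                  ∣A∣ (trans ∣B∣ (+-comm k 1)) (trans ∣D∣ (+-comm k 1)) (side ∘ f))
               (lost-edges G H H⊆G (side ∘ f) (colouring-sides H f (≤-pred m<3) f-proper)))
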